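{- Let $k,q\ge 1$ be integers and let $V=[q]^k$ be the set of $k$-tuples over $[q]=\{1,\dots,q\}$. Let $\pi_0$ be the identity map on $V$, and for $1\le i\le k$ let $\pi_i:V\to(\{0\}\cup[q])^k$ be the map that replaces the $i$-th coordinate of a tuple by $0$ and keeps all other coordinates. Say that $\pi_i$ separates $S\subseteq V$ if $\pi_i(\alpha)\ne\pi_i(\beta)$ for all distinct $\alpha,\beta\in S$. If $S\subseteq V$ has $|S|=t$ with $1\le t\le k+1$, then at most $t-1$ of the maps $\pi_0,\pi_1,\ldots,\pi_k$ fail to separate $S$. -}

module Defs where

open import Data.Nat using (ℕ; suc)
open import Data.Fin using (Fin; zero; suc)
open import Data.Vec using (Vec; map; _[_]≔_)
open import Data.List using (List)
open import Data.List.Membership.Propositional using (_∈_)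
open import Relation.Binary.PropositionalEquality using (_≡_; _≢_)

-- [q] is modelled by Fin q; ({0} ∪ [q]) by Fin (suc q), where zero plays
-- the role of 0 and suc j the role of the element j of [q].
-- V = [q]^k
V : ℕ → ℕ → Set
V q k = Vec (Fin q) k

-- π i for i : Fin (suc k):  i = zero is π_0 (identity, viewed inside
-- ({0} ∪ [q])^k via the embedding suc), and i = suc j is π_{j+1}, which
-- replaces coordinate j (0-based) by 0.
π : ∀ {q k} → Fin (suc k) → V q k → Vec (Fin (suc q)) k
π zero    α = map suc α
π (suc j) α = map suc α [ j ]≔ zero

Separates : ∀ {q k} → Fin (suc k) → List (V q k) → Set
Separates i S = ∀ {α β} → α ∈ S → β ∈ S → α ≢ β → π i α ≢ π i β

module Submission where

-- Write π_i = e_i ∘ ι, where ι : [q]^k → ({0} ∪ [q])^k is the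
-- injective embedding and e_0 = id, e_{j+1} = "overwrite coordinate j by 0".
-- A map that fails to separate S has a collision: two distinct members of S
-- that it identifies.  The bound is proved by induction on the list I of
-- failing maps, for the erasures e_i acting on an arbitrary list S of vectors
-- over any alphabet with a blank symbol (duplicates in S are allowed):
--   * e_0 = id never has a collision;
--   * if e_{j+1} collides α ≠ β in S, delete β from S and apply e_{j+1} to
--     the rest, obtaining S' with |S'| = |S| - 1 ∋ e_{j+1} α.  Every
--     collision of another erasure e_{j'+1} in S survives in S', because
--     erasures commute and two vectors identified by e_{j'+1} but distinct
--     differ at coordinate j', which e_{j+1} does not touch.

open import Defs
open import Data.Nat using (ℕ; suc; _≤_; _∸_; z≤n; pred; NonZero)
open import Data.Nat.Properties using (m≤pred[n]⇒suc[m]≤n)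
open import Data.Fin using (Fin; zero; suc; _≟_)
open import Data.Fin.Properties using (suc-injective)
open import Data.List using (List; []; _∷_; length; map)
open import Data.List.Properties using (length-map; length-removeAt′)
open import Data.List.Relation.Unary.All as All using (All; _∷_)
open import Data.List.Relation.Unary.Any using (here; there; index; _─_; any?)
open import Data.List.Relation.Unary.AllPairs using (_∷_)
open import Data.List.Relation.Unary.Unique.Propositional using (Unique)
open import Data.List.Membership.Propositional using (_∈_; find; lose)
open import Data.List.Membership.Propositional.Properties using (∈-map⁺)
open import Data.Vec as Vec using (Vec; []; _∷_; lookup; _[_]≔_)
open import Data.Vec.Properties
  using (≡-dec; ∷-injective; []≔-commutes; []≔-idempotent; []≔-lookup; lookup∘update′)
open import Data.Product using (_,_)
open import Data.Sum using (_⊎_; inj₁; inj₂)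
open import Data.Empty using (⊥-elim)
open import Function using (_∘_)
open import Relation.Nullary using (¬_; yes; no; ¬?)
open import Relation.Nullary.Decidable using (_×-dec_)
open import Relation.Binary.Definitions using (DecidableEquality)
open import Relation.Binary.PropositionalEquality
  using (_≡_; _≢_; refl; sym; trans; cong; cong₂; subst; module ≡-Reasoning)
open ≡-Reasoning

record Collision {A B : Set} (f : A → B) (S : List A) : Set where
  constructor collision
  field
    {x y} : A
    x∈S   : x ∈ S
    y∈S   : y ∈ S
    x≢y   : x ≢ y
    fx≡fy : f x ≡ f y

¬separating⇒collision :
  {A B : Set} → DecidableEquality A → DecidableEquality B →
  (f : A → B) (S : List A) →
  ¬ (∀ {x y} → x ∈ S → y ∈ S → x ≢ y → f x ≢ f y) → Collision f S
¬separating⇒collision _≟A_ _≟B_ f S not-separating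
  with any? (λ x → any? (λ y → ¬? (x ≟A y) ×-dec (f x ≟B f y)) S) S
... | no none = ⊥-elim (not-separating λ x∈S y∈S x≢y fx≡fy →
                  none (lose x∈S (lose y∈S (x≢y , fx≡fy))))
... | yes some with find some
...   | x , x∈S , some-y with find some-y
...     | y , y∈S , x≢y , fx≡fy = collision x∈S y∈S x≢y fx≡fy

collision-map :
  {A A′ B : Set} {f : A → B} {h : A′ → B} {S : List A} (g : A → A′) →
  (∀ {x y} → g x ≡ g y → x ≡ y) → (∀ x → f x ≡ h (g x)) →
  Collision f S → Collision h (map g S)
collision-map g g-injective f≡h∘g (collision x∈S y∈S x≢y fx≡fy) =
  collision (∈-map⁺ g x∈S) (∈-map⁺ g y∈S) (x≢y ∘ g-injective)
    (trans (sym (f≡h∘g _)) (trans fx≡fy (f≡h∘g _)))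

length-─ : {A : Set} {x : A} (xs : List A) (x∈xs : x ∈ xs) →
           length xs ≡ suc (length (xs ─ x∈xs))
length-─ xs x∈xs = length-removeAt′ xs (index x∈xs)

∈-─ : {A : Set} {x y : A} (xs : List A) (x∈xs : x ∈ xs) →
      y ∈ xs → y ≡ x ⊎ y ∈ (xs ─ x∈xs)
∈-─ (_ ∷ _)  (here refl) (here y≡x)  = inj₁ y≡x
∈-─ (_ ∷ _)  (here refl) (there y∈xs) = inj₂ y∈xs
∈-─ (_ ∷ _)  (there x∈xs) (here y≡z) = inj₂ (here y≡z)
∈-─ (_ ∷ xs) (there x∈xs) (there y∈xs) with ∈-─ xs x∈xs y∈xs
... | inj₁ y≡x   = inj₁ y≡x
... | inj₂ y∈xs─ = inj₂ (there y∈xs─)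

∈⇒nonZero-length : {A : Set} {x : A} {xs : List A} → x ∈ xs → NonZero (length xs)
∈⇒nonZero-length {xs = _ ∷ _} _ = _

agree-off-and-at⇒≡ : {A : Set} {k : ℕ} {c : A} (j : Fin k) (α β : Vec A k) →
                     α [ j ]≔ c ≡ β [ j ]≔ c → lookup α j ≡ lookup β j → α ≡ β
agree-off-and-at⇒≡ {c = c} j α β off at = begin
  α                              ≡⟨ sym ([]≔-lookup α j) ⟩
  α [ j ]≔ lookup α j            ≡⟨ sym ([]≔-idempotent α j) ⟩
  (α [ j ]≔ c) [ j ]≔ lookup α j ≡⟨ cong₂ (λ v a → v [ j ]≔ a) off at ⟩
  (β [ j ]≔ c) [ j ]≔ lookup β j ≡⟨ []≔-idempotent β j ⟩
  β [ j ]≔ lookup β j            ≡⟨ []≔-lookup β j ⟩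
  β                              ∎

module Erasure {A : Set} (blank : A) where

  erase : {k : ℕ} → Fin (suc k) → Vec A k → Vec A k
  erase zero    α = α
  erase (suc j) α = α [ j ]≔ blank

  no-collision-zero : {k : ℕ} (S : List (Vec A k)) → ¬ Collision (erase zero) S
  no-collision-zero S c = Collision.x≢y c (Collision.fx≡fy c)

  contract : {k : ℕ} {j : Fin k} {S : List (Vec A k)} →
             Collision (erase (suc j)) S → List (Vec A k)
  contract {j = j} {S} c = map (erase (suc j)) (S ─ Collision.y∈S c)

  length-contract : {k : ℕ} {j : Fin k} {S : List (Vec A k)}
                    (c : Collision (erase (suc j)) S) →
                    length S ≡ suc (length (contract c))
  length-contract {j = j} {S} c = trans (length-─ S (Collision.y∈S c))
    (cong suc (sym (length-map (erase (suc j)) (S ─ Collision.y∈S c))))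

  -- The erased image of every member of S lies in the contraction (β is
  -- sent to e_{j+1} β = e_{j+1} α).
  erase-∈-contract : {k : ℕ} {j : Fin k} {S : List (Vec A k)}
                     (c : Collision (erase (suc j)) S) {γ : Vec A k} →
                     γ ∈ S → erase (suc j) γ ∈ contract c
  erase-∈-contract {j = j} {S} c@(collision x∈S y∈S x≢y ex≡ey) γ∈S
    with ∈-─ S y∈S γ∈S
  ... | inj₂ γ∈S─ = ∈-map⁺ (erase (suc j)) γ∈S─
  ... | inj₁ refl with ∈-─ S y∈S x∈S
  ...   | inj₁ x≡y  = ⊥-elim (x≢y x≡y)
  ...   | inj₂ x∈S─ = subst (_∈ contract c) ex≡ey (∈-map⁺ (erase (suc j)) x∈S─)

  collision-contract : {k : ℕ} {j : Fin k} {S : List (Vec A k)}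
                       (c : Collision (erase (suc j)) S) (i : Fin (suc k)) →
                       suc j ≢ i → Collision (erase i) S →
                       Collision (erase i) (contract c)
  collision-contract c zero _ d = ⊥-elim (no-collision-zero _ d)
  collision-contract {j = j} c (suc j′) j≢j′ (collision {α} {β} α∈S β∈S α≢β eα≡eβ) =
    collision (erase-∈-contract c α∈S) (erase-∈-contract c β∈S) still-distinct
      (begin
        (α [ j ]≔ blank) [ j′ ]≔ blank ≡⟨ erasures-commute α ⟩
        (α [ j′ ]≔ blank) [ j ]≔ blank ≡⟨ cong (_[ j ]≔ blank) eα≡eβ ⟩
        (β [ j′ ]≔ blank) [ j ]≔ blank ≡⟨ sym (erasures-commute β) ⟩
        (β [ j ]≔ blank) [ j′ ]≔ blank ∎)
    where
    j′≢j : j′ ≢ j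
    j′≢j j′≡j = j≢j′ (cong suc (sym j′≡j))

    erasures-commute : (γ : Vec A _) →
      (γ [ j ]≔ blank) [ j′ ]≔ blank ≡ (γ [ j′ ]≔ blank) [ j ]≔ blank
    erasures-commute γ = []≔-commutes γ j j′ (j′≢j ∘ sym)

    still-distinct : α [ j ]≔ blank ≢ β [ j ]≔ blank
    still-distinct eα≡eβ′ = α≢β (agree-off-and-at⇒≡ j′ α β eα≡eβ (begin
      lookup α j′                  ≡⟨ sym (lookup∘update′ j′≢j α blank) ⟩
      lookup (α [ j ]≔ blank) j′   ≡⟨ cong (λ v → lookup v j′) eα≡eβ′ ⟩
      lookup (β [ j ]≔ blank) j′   ≡⟨ lookup∘update′ j′≢j β blank ⟩
      lookup β j′                  ∎))

  collision-bound : {k : ℕ} (S : List (Vec A k)) (I : List (Fin (suc k))) →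
                    Unique I → All (λ i → Collision (erase i) S) I →
                    length I ≤ pred (length S)
  collision-bound S [] _ _ = z≤n
  collision-bound S (zero ∷ I) _ (c ∷ _) = ⊥-elim (no-collision-zero S c)
  collision-bound S (suc j ∷ I) (j∉I ∷ I-unique) (c ∷ cs) =
    subst (λ n → suc (length I) ≤ pred n) (sym (length-contract c))
      (m≤pred[n]⇒suc[m]≤n {{∈⇒nonZero-length (erase-∈-contract c x∈S)}}
        (collision-bound (contract c) I I-unique survivors))
    where
    open Collision c using (x∈S)
    survivors : All (λ i → Collision (erase i) (contract c)) I
    survivors = All.zipWith (λ {i} (j≢i , d) → collision-contract c i j≢i d) (j∉I , cs)

ι : {q k : ℕ} → V q k → Vec (Fin (suc q)) k
ι = Vec.map suc

ι-injective : {q k : ℕ} {α β : V q k} → ι α ≡ ι β → α ≡ β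
ι-injective {α = []}    {[]}    _ = refl
ι-injective {α = _ ∷ _} {_ ∷ _} ια≡ιβ with ∷-injective ια≡ιβ
... | head≡ , tail≡ = cong₂ _∷_ (suc-injective head≡) (ι-injective tail≡)

open module ZeroBlank {q : ℕ} = Erasure {Fin (suc q)} zero using (erase; collision-bound)

π≡erase∘ι : {q k : ℕ} (i : Fin (suc k)) (α : V q k) → π i α ≡ erase i (ι α)
π≡erase∘ι zero    α = refl
π≡erase∘ι (suc j) α = refl

failure⇒collision : {q k : ℕ} (S : List (V q k)) (i : Fin (suc k)) →
                    ¬ Separates i S → Collision (erase i) (map ι S)
failure⇒collision S i not-separating =
  collision-map ι ι-injective (π≡erase∘ι i)
    (¬separating⇒collision (≡-dec _≟_) (≡-dec _≟_) (π i) S not-separating)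

-- The theorem.
lemma4p3 : (k q : ℕ) → 1 ≤ k → 1 ≤ q →
           (S : List (V q k)) → Unique S →
           1 ≤ length S → length S ≤ suc k →
           (I : List (Fin (suc k))) → Unique I →
           All (λ i → ¬ Separates i S) I →
           length I ≤ length S ∸ 1
lemma4p3 k q _ _ S _ _ _ I I-unique failing =
  subst (λ n → length I ≤ pred n) (length-map ι S)
    (collision-bound (map ι S) I I-unique
      (All.map (λ {i} → failure⇒collision S i) failing))
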